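{- Let $p_n$ be the number of pop-stacked permutations of size $n$. Then $p_n\ge \exp\big(n\ln n-n\ln 2-n+o(n)\big)$ as $n\to\infty$.
   Context: Falls of a permutation are its maximal decreasing strings of consecutive entries. The flip $T$ reverses every fall in place; a permutation is pop-stacked if it lies in the image of $T$. -}

module Defs where

open import Data.Nat using (ℕ; zero; suc; _<?_; _≟_)
open import Data.List using (List; []; _∷_; map; concat; concatMap; reverse; length; deduplicate)
open import Data.List.Properties using (≡-dec)
open import Relation.Nullary using (yes; no)

-- A permutation of size n is a word (list) using each of 1,…,n exactly once.

insertions : ℕ → List ℕ → List (List ℕ)
insertions x [] = (x ∷ []) ∷ []
insertions x (y ∷ ys) = (x ∷ y ∷ ys) ∷ map (y ∷_) (insertions x ys)

perms : ℕ → List (List ℕ)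
perms zero = [] ∷ []
perms (suc n) = concatMap (insertions (suc n)) (perms n)

addTo : ℕ → List (List ℕ) → List (List ℕ)
addTo x ((y ∷ r) ∷ rs) with y <? x
... | yes _ = (x ∷ y ∷ r) ∷ rs
... | no _ = (x ∷ []) ∷ (y ∷ r) ∷ rs
addTo x rs = (x ∷ []) ∷ rs

-- decomposition of a word into its falls (maximal decreasing runs of
-- consecutive entries), left to right
falls : List ℕ → List (List ℕ)
falls [] = []
falls (x ∷ xs) = addTo x (falls xs)

flipT : List ℕ → List ℕ
flipT w = concat (map reverse (falls w))

-- p n = number of pop-stacked permutations of size n
--     = number of distinct elements of the image T(S_n)
popStackedCount : ℕ → ℕ
popStackedCount n = length (deduplicate (≡-dec _≟_) (map flipT (perms n)))

-- A word w is determined by its flip T w together with the lengths of its falls, a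
-- composition of n that n bits can encode; hence n! ≤ p_n 2^n. On the other hand
-- n^n / n! = ∏_{k<n} (1 + 1/k)^k, and (1 + 1/k)^k ≤ (1 + 1/m)^(m+1) for all k and all m ≥ 1,
-- because by Bernoulli's inequality the left side increases with k and the right side
-- decreases with m. Hence n^n m^((m+1)n) ≤ n! (m+1)^((m+1)n) ≤ p_n (2 (m+1)^(m+1))^n for all n.

{-# OPTIONS --safe #-}
module Submission where

open import Defs
open import Data.Nat using (ℕ; suc; _+_; _*_; _^_; _≤_)
open import Data.Product using (∃)

open import Data.Bool using (Bool; true; false)
open import Data.Empty using (⊥-elim)
open import Data.List
  using (List; []; _∷_; _++_; map; concat; concatMap; reverse; length; filter; deduplicate; cartesianProductWith)
open import Data.List.Properties
  using (length-++; length-map; length-reverse; length-removeAt′; reverse-involutive; map-∘; map-cong; map-id;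
         filter-all; filter-reject; ≡-dec)
open import Data.List.Relation.Unary.All as All using (All; []; _∷_)
open import Data.List.Relation.Unary.Any using (here; there; _─_)
open import Data.List.Relation.Unary.AllPairs using ([]; _∷_)
open import Data.List.Relation.Unary.Unique.Propositional using (Unique)
import Data.List.Relation.Unary.Unique.Propositional.Properties as Unique
open import Data.List.Relation.Binary.Subset.Propositional using (_⊆_)
open import Data.List.Membership.Propositional using (_∈_; _∉_; find)
open import Data.List.Membership.Propositional.Properties
  using (∈-map⁺; ∈-map⁻; ∈-concatMap⁻; ∈-cartesianProductWith⁺; ∈-deduplicate⁺)
open import Data.Nat using (zero; _!; _<_; _<?_; >-nonZero; z≤n; s≤s; z<s; _≤′_; ≤′-refl; ≤′-step; _≟_; _≤?_)
open import Data.Nat.ListAction using (sum)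
open import Data.Nat.Properties
open import Data.Product using (_,_; _×_; proj₁; proj₂)
open import Data.Sum using (inj₁; inj₂)
open import Data.Nat.Tactic.RingSolver using (solve-∀)
open import Function using (_∘_)
open import Relation.Binary.PropositionalEquality
open import Relation.Nullary using (¬_; yes; no)
open import Relation.Unary using (Pred; Decidable)
open import Level using (0ℓ)

-- Counting lists

module _ {A : Set} where

  ∈-─⁺ : ∀ {x y} {ys : List A} (p : y ∈ ys) → x ≢ y → x ∈ ys → x ∈ (ys ─ p)
  ∈-─⁺ (here refl) x≢y (here refl) = ⊥-elim (x≢y refl)
  ∈-─⁺ (here refl) x≢y (there q)   = q
  ∈-─⁺ (there p)   x≢y (here refl) = here refl
  ∈-─⁺ (there p)   x≢y (there q)   = there (∈-─⁺ p x≢y q)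

  Unique∧⊆⇒length≤ : {xs ys : List A} → Unique xs → xs ⊆ ys → length xs ≤ length ys
  Unique∧⊆⇒length≤ {[]}          _          _       = z≤n
  Unique∧⊆⇒length≤ {x ∷ xs} {ys} (x∉xs ∷ u) x∷xs⊆ys = begin
    suc (length xs)              ≤⟨ s≤s (Unique∧⊆⇒length≤ u xs⊆ys─x) ⟩
    suc (length (ys ─ x∈ys))     ≡⟨ length-removeAt′ ys _ ⟨
    length ys                    ∎
    where
    open ≤-Reasoning
    x∈ys = x∷xs⊆ys (here refl)
    xs⊆ys─x : xs ⊆ (ys ─ x∈ys)
    xs⊆ys─x z∈xs = ∈-─⁺ x∈ys (λ z≡x → All.lookup x∉xs z∈xs (sym z≡x)) (x∷xs⊆ys (there z∈xs))

module _ {A B : Set} where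

  length-concatMap-const : ∀ (f : A → List B) {k} xs → (∀ {x} → x ∈ xs → length (f x) ≡ k) →
                           length (concatMap f xs) ≡ length xs * k
  length-concatMap-const f     []       _   = refl
  length-concatMap-const f {k} (x ∷ xs) len = begin
    length (f x ++ concatMap f xs)          ≡⟨ length-++ (f x) ⟩
    length (f x) + length (concatMap f xs)  ≡⟨ cong₂ _+_ (len (here refl)) (length-concatMap-const f xs (len ∘ there)) ⟩
    k + length xs * k                       ∎
    where open ≡-Reasoning

  -- r retracts each block f x onto x, so distinct x give disjoint blocks.
  concatMap-Unique : ∀ (f : A → List B) (r : B → A) {xs} → Unique xs →
                     (∀ {x} → x ∈ xs → Unique (f x)) → (∀ {x y} → x ∈ xs → y ∈ f x → r y ≡ x) →
                     Unique (concatMap f xs)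
  concatMap-Unique f r {[]}     []         _       _       = []
  concatMap-Unique f r {x ∷ xs} (x∉xs ∷ u) uniq-f retract =
    Unique.++⁺ (uniq-f (here refl)) (concatMap-Unique f r u (uniq-f ∘ there) (retract ∘ there)) disjoint
    where
    disjoint : ∀ {y} → ¬ (y ∈ f x × y ∈ concatMap f xs)
    disjoint (y∈fx , y∈rest) with find (∈-concatMap⁻ f y∈rest)
    ... | x′ , x′∈xs , y∈fx′ = All.lookup x∉xs x′∈xs (trans (sym (retract (here refl) y∈fx)) (retract (there x′∈xs) y∈fx′))

module _ {A B C : Set} (f : A → B → C) where

  length-cartesianProductWith : ∀ xs ys → length (cartesianProductWith f xs ys) ≡ length xs * length ys
  length-cartesianProductWith []       ys = refl
  length-cartesianProductWith (x ∷ xs) ys = begin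
    length (map (f x) ys ++ cartesianProductWith f xs ys)          ≡⟨ length-++ (map (f x) ys) ⟩
    length (map (f x) ys) + length (cartesianProductWith f xs ys)  ≡⟨ cong₂ _+_ (length-map (f x) ys) (length-cartesianProductWith xs ys) ⟩
    length ys + length xs * length ys                              ∎
    where open ≡-Reasoning

bitStrings : ℕ → List (List Bool)
bitStrings zero    = [] ∷ []
bitStrings (suc n) = cartesianProductWith _∷_ (true ∷ false ∷ []) (bitStrings n)

length-bitStrings : ∀ n → length (bitStrings n) ≡ 2 ^ n
length-bitStrings zero    = refl
length-bitStrings (suc n) =
  trans (length-cartesianProductWith _∷_ (true ∷ false ∷ []) (bitStrings n)) (cong (2 *_) (length-bitStrings n))

∈-bitStrings : ∀ bs → bs ∈ bitStrings (length bs)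
∈-bitStrings []       = here refl
∈-bitStrings (b ∷ bs) = ∈-cartesianProductWith⁺ _∷_ (bit∈ b) (∈-bitStrings bs)
  where
  bit∈ : ∀ b → b ∈ true ∷ false ∷ []
  bit∈ true  = here refl
  bit∈ false = there (here refl)

-- Permutations

length-insertions : ∀ x w → length (insertions x w) ≡ suc (length w)
length-insertions x []       = refl
length-insertions x (y ∷ ys) = cong suc (trans (length-map (y ∷_) (insertions x ys)) (length-insertions x ys))

module _ {x : ℕ} where

  ∈-insertions⇒length : ∀ {z} w → z ∈ insertions x w → length z ≡ suc (length w)
  ∈-insertions⇒length []       (here refl) = refl
  ∈-insertions⇒length (y ∷ ys) (here refl) = refl
  ∈-insertions⇒length (y ∷ ys) (there p) with ∈-map⁻ (y ∷_) p
  ... | z , z∈ , refl = cong suc (∈-insertions⇒length ys z∈)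

  ∈-insertions⇒All : ∀ {P : Pred ℕ 0ℓ} {z} w → P x → All P w → z ∈ insertions x w → All P z
  ∈-insertions⇒All []       px pw        (here refl) = px ∷ []
  ∈-insertions⇒All (y ∷ ys) px pw        (here refl) = px ∷ pw
  ∈-insertions⇒All (y ∷ ys) px (py ∷ pw) (there p) with ∈-map⁻ (y ∷_) p
  ... | z , z∈ , refl = py ∷ ∈-insertions⇒All ys px pw z∈

  ∈-insertions⇒filter : ∀ {P : Pred ℕ 0ℓ} (P? : Decidable P) {z} w → ¬ P x →
                        z ∈ insertions x w → filter P? z ≡ filter P? w
  ∈-insertions⇒filter P? []       ¬px (here refl) = filter-reject P? ¬px
  ∈-insertions⇒filter P? (y ∷ ys) ¬px (here refl) = filter-reject P? ¬px
  ∈-insertions⇒filter P? (y ∷ ys) ¬px (there p) with ∈-map⁻ (y ∷_) p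
  ... | z , z∈ , refl with P? y
  ...   | yes _ = cong (y ∷_) (∈-insertions⇒filter P? ys ¬px z∈)
  ...   | no  _ = ∈-insertions⇒filter P? ys ¬px z∈

  insertions-Unique : ∀ w → x ∉ w → Unique (insertions x w)
  insertions-Unique []       _   = [] ∷ []
  insertions-Unique (y ∷ ys) x∉w =
    All.tabulate head-new ∷ Unique.map⁺ ∷-injectiveʳ (insertions-Unique ys (x∉w ∘ there))
    where
    ∷-injectiveʳ : ∀ {a b : List ℕ} → y ∷ a ≡ y ∷ b → a ≡ b
    ∷-injectiveʳ refl = refl
    head-new : ∀ {z} → z ∈ map (y ∷_) (insertions x ys) → x ∷ y ∷ ys ≢ z
    head-new p eq with ∈-map⁻ (y ∷_) p
    head-new p refl | _ , _ , refl = x∉w (here refl)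

∈-perms⁻ : ∀ n {w} → w ∈ perms n → length w ≡ n × All (_≤ n) w
∈-perms⁻ zero    (here refl) = refl , []
∈-perms⁻ (suc n) w∈ with find (∈-concatMap⁻ (insertions (suc n)) w∈)
... | v , v∈ , w∈ins with ∈-perms⁻ n v∈
...   | len-v , v≤n = trans (∈-insertions⇒length v w∈ins) (cong suc len-v)
                    , ∈-insertions⇒All v ≤-refl (All.map m≤n⇒m≤1+n v≤n) w∈ins

length-perms : ∀ n → length (perms n) ≡ n !
length-perms zero    = refl
length-perms (suc n) = begin
  length (perms (suc n))     ≡⟨ length-concatMap-const (insertions (suc n)) (perms n) length-ins ⟩
  length (perms n) * suc n   ≡⟨ cong (_* suc n) (length-perms n) ⟩
  n ! * suc n                ≡⟨ *-comm (n !) (suc n) ⟩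
  suc n !                    ∎
  where
  open ≡-Reasoning
  length-ins : ∀ {v} → v ∈ perms n → length (insertions (suc n) v) ≡ suc n
  length-ins {v} v∈ = trans (length-insertions (suc n) v) (cong suc (proj₁ (∈-perms⁻ n v∈)))

-- Filtering out the entry n + 1 recovers the permutation it was inserted into.
perms-Unique : ∀ n → Unique (perms n)
perms-Unique zero    = [] ∷ []
perms-Unique (suc n) = concatMap-Unique (insertions (suc n)) (filter (_≤? n)) (perms-Unique n)
  (λ v∈ → insertions-Unique _ (λ n+1∈v → 1+n≰n (All.lookup (proj₂ (∈-perms⁻ n v∈)) n+1∈v)))
  (λ {v} v∈ w∈ → trans (∈-insertions⇒filter (_≤? n) v 1+n≰n w∈) (filter-all (_≤? n) (proj₂ (∈-perms⁻ n v∈))))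

-- Recovering a word from its flip and the lengths of its falls

concat-addTo : ∀ x rs → concat (addTo x rs) ≡ x ∷ concat rs
concat-addTo x []             = refl
concat-addTo x ([] ∷ rs)      = refl
concat-addTo x ((y ∷ r) ∷ rs) with y <? x
... | yes _ = refl
... | no  _ = refl

concat-falls : ∀ w → concat (falls w) ≡ w
concat-falls []       = refl
concat-falls (x ∷ xs) = trans (concat-addTo x (falls xs)) (cong (x ∷_) (concat-falls xs))

addTo-nonempty : ∀ x rs → All (0 <_) (map length rs) → All (0 <_) (map length (addTo x rs))
addTo-nonempty x []             p       = z<s ∷ []
addTo-nonempty x ([] ∷ rs)      p       = z<s ∷ p
addTo-nonempty x ((y ∷ r) ∷ rs) (q ∷ p) with y <? x
... | yes _ = z<s ∷ p
... | no  _ = z<s ∷ q ∷ p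

falls-nonempty : ∀ w → All (0 <_) (map length (falls w))
falls-nonempty []       = []
falls-nonempty (x ∷ xs) = addTo-nonempty x (falls xs) (falls-nonempty xs)

-- A composition (k₁, …, kᵣ) is encoded as the bit string 0^(k₁−1) 1 ⋯ 0^(kᵣ−1) 1,
-- which marks the last position of every part.
partBits : ℕ → List Bool
partBits zero          = []
partBits (suc zero)    = true ∷ []
partBits (suc (suc k)) = false ∷ partBits (suc k)

compositionBits : List ℕ → List Bool
compositionBits = concatMap partBits

length-partBits : ∀ k → length (partBits k) ≡ k
length-partBits zero          = refl
length-partBits (suc zero)    = refl
length-partBits (suc (suc k)) = cong suc (length-partBits (suc k))

length-compositionBits : ∀ ks → length (compositionBits ks) ≡ sum ks
length-compositionBits []       = refl
length-compositionBits (k ∷ ks) = trans (length-++ (partBits k)) (cong₂ _+_ (length-partBits k) (length-compositionBits ks))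

module _ {A : Set} where

  splitByBits : List Bool → List A → List (List A)
  splitByBits []           _        = []
  splitByBits (_ ∷ _)      []       = []
  splitByBits (true ∷ bs)  (x ∷ xs) = (x ∷ []) ∷ splitByBits bs xs
  splitByBits (false ∷ bs) (x ∷ xs) = consHead (splitByBits bs xs)
    where
    consHead : List (List A) → List (List A)
    consHead []       = (x ∷ []) ∷ []
    consHead (g ∷ gs) = (x ∷ g) ∷ gs

  splitByBits-partBits : ∀ x r bs xs →
    splitByBits (partBits (length (x ∷ r)) ++ bs) ((x ∷ r) ++ xs) ≡ (x ∷ r) ∷ splitByBits bs xs
  splitByBits-partBits x []      bs xs = refl
  splitByBits-partBits x (y ∷ r) bs xs rewrite splitByBits-partBits y r bs xs = refl

  splitByBits-compositionBits : ∀ gs → All (0 <_) (map length gs) →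
                                splitByBits (compositionBits (map length gs)) (concat gs) ≡ gs
  splitByBits-compositionBits []             []      = refl
  splitByBits-compositionBits ((x ∷ r) ∷ gs) (_ ∷ p) =
    trans (splitByBits-partBits x r _ (concat gs)) (cong ((x ∷ r) ∷_) (splitByBits-compositionBits gs p))

  sum-map-length : ∀ (gs : List (List A)) → sum (map length gs) ≡ length (concat gs)
  sum-map-length []       = refl
  sum-map-length (g ∷ gs) = trans (cong (length g +_) (sum-map-length gs)) (sym (length-++ g))

  map-length-reverse : ∀ (gs : List (List A)) → map length (map reverse gs) ≡ map length gs
  map-length-reverse gs = trans (sym (map-∘ gs)) (map-cong length-reverse gs)

  map-reverse-involutive : ∀ (gs : List (List A)) → map reverse (map reverse gs) ≡ gs
  map-reverse-involutive gs = trans (sym (map-∘ gs)) (trans (map-cong reverse-involutive gs) (map-id gs))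

fallShape : List ℕ → List Bool
fallShape w = compositionBits (map length (falls w))

length-fallShape : ∀ w → length (fallShape w) ≡ length w
length-fallShape w = begin
  length (compositionBits (map length (falls w)))  ≡⟨ length-compositionBits (map length (falls w)) ⟩
  sum (map length (falls w))                       ≡⟨ sum-map-length (falls w) ⟩
  length (concat (falls w))                        ≡⟨ cong length (concat-falls w) ⟩
  length w                                         ∎
  where open ≡-Reasoning

unflip : List ℕ → List Bool → List ℕ
unflip v bs = concatMap reverse (splitByBits bs v)

-- The falls of w and of flipT w have the same lengths.
unflip-flipT : ∀ w → unflip (flipT w) (fallShape w) ≡ w
unflip-flipT w = begin
  concatMap reverse (splitByBits (compositionBits (map length fs)) (concat rfs))
    ≡⟨ cong (λ ls → concatMap reverse (splitByBits (compositionBits ls) (concat rfs))) (map-length-reverse fs) ⟨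
  concatMap reverse (splitByBits (compositionBits (map length rfs)) (concat rfs))
    ≡⟨ cong (concatMap reverse) (splitByBits-compositionBits rfs rfs-nonempty) ⟩
  concat (map reverse rfs)
    ≡⟨ cong concat (map-reverse-involutive fs) ⟩
  concat fs
    ≡⟨ concat-falls w ⟩
  w ∎
  where
  open ≡-Reasoning
  fs  = falls w
  rfs = map reverse fs
  rfs-nonempty : All (0 <_) (map length rfs)
  rfs-nonempty = subst (All (0 <_)) (sym (map-length-reverse fs)) (falls-nonempty w)

n!≤popStackedCount*2^n : ∀ n → n ! ≤ popStackedCount n * 2 ^ n
n!≤popStackedCount*2^n n = begin
  n !                                                 ≡⟨ length-perms n ⟨
  length (perms n)                                    ≤⟨ Unique∧⊆⇒length≤ (perms-Unique n) perms⊆ ⟩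
  length (cartesianProductWith unflip image (bitStrings n))
                                                      ≡⟨ length-cartesianProductWith unflip image (bitStrings n) ⟩
  length image * length (bitStrings n)                ≡⟨ cong (length image *_) (length-bitStrings n) ⟩
  popStackedCount n * 2 ^ n                           ∎
  where
  open ≤-Reasoning
  image = deduplicate (≡-dec _≟_) (map flipT (perms n))
  perms⊆ : perms n ⊆ cartesianProductWith unflip image (bitStrings n)
  perms⊆ {w} w∈ = subst (_∈ cartesianProductWith unflip image (bitStrings n)) (unflip-flipT w)
    (∈-cartesianProductWith⁺ unflip (∈-deduplicate⁺ (≡-dec _≟_) (∈-map⁺ flipT w∈))
      (subst (λ k → fallShape w ∈ bitStrings k) (trans (length-fallShape w) (proj₁ (∈-perms⁻ n w∈)))
        (∈-bitStrings (fallShape w))))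

-- Comparing (1 + 1/k)^k with (1 + 1/m)^(m+1)

bernoulli-upper : ∀ D B n → (D + B) ^ suc n ≤ D ^ suc n + suc n * B * (D + B) ^ n
bernoulli-upper D B zero    = ≤-reflexive (base D B)
  where
  base : ∀ D B → (D + B) * 1 ≡ D * 1 + 1 * B * 1
  base = solve-∀
bernoulli-upper D B (suc n) = begin
  (D + B) * (D + B) ^ suc n                                         ≤⟨ *-monoʳ-≤ (D + B) (bernoulli-upper D B n) ⟩
  (D + B) * (D ^ suc n + suc n * B * (D + B) ^ n)                   ≡⟨ expand D B n (D ^ suc n) ((D + B) ^ n) ⟩
  D * D ^ suc n + B * D ^ suc n + suc n * B * (D + B) ^ suc n        ≤⟨ +-monoˡ-≤ _ (+-monoʳ-≤ (D * D ^ suc n) (*-monoʳ-≤ B D^n+1≤)) ⟩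
  D * D ^ suc n + B * (D + B) ^ suc n + suc n * B * (D + B) ^ suc n  ≡⟨ collect D B n (D * D ^ suc n) ((D + B) ^ suc n) ⟩
  D * D ^ suc n + suc (suc n) * B * (D + B) ^ suc n                  ∎
  where
  open ≤-Reasoning
  D^n+1≤ : D ^ suc n ≤ (D + B) ^ suc n
  D^n+1≤ = ^-monoˡ-≤ (suc n) (m≤m+n D B)
  expand : ∀ D B n x y → (D + B) * (x + suc n * B * y) ≡ D * x + B * x + suc n * B * ((D + B) * y)
  expand = solve-∀
  collect : ∀ D B n x y → x + B * y + suc n * B * y ≡ x + suc (suc n) * B * y
  collect = solve-∀

bernoulli-lower : ∀ D B n → D ^ suc n + suc n * B * D ^ n ≤ (D + B) ^ suc n
bernoulli-lower D B zero    = ≤-reflexive (base D B)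
  where
  base : ∀ D B → D * 1 + 1 * B * 1 ≡ (D + B) * 1
  base = solve-∀
bernoulli-lower D B (suc n) = begin
  D * D ^ suc n + suc (suc n) * B * D ^ suc n                             ≤⟨ m≤m+n _ _ ⟩
  D * (D * D ^ n) + suc (suc n) * B * (D * D ^ n) + suc n * B * B * D ^ n  ≡⟨ factor D B n (D ^ n) ⟩
  (D + B) * (D ^ suc n + suc n * B * D ^ n)                                ≤⟨ *-monoʳ-≤ (D + B) (bernoulli-lower D B n) ⟩
  (D + B) * (D + B) ^ suc n                                                ∎
  where
  open ≤-Reasoning
  factor : ∀ D B n x → D * (D * x) + suc (suc n) * B * (D * x) + suc n * B * B * x ≡ (D + B) * (D * x + suc n * B * x)
  factor = solve-∀

^-distribʳ-* : ∀ m n o → (m * n) ^ o ≡ m ^ o * n ^ o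
^-distribʳ-* m n zero    = refl
^-distribʳ-* m n (suc o) = trans (cong (m * n *_) (^-distribʳ-* m n o)) (interchange m n (m ^ o) (n ^ o))
  where
  interchange : ∀ a b c d → a * b * (c * d) ≡ a * c * (b * d)
  interchange = solve-∀

-- The pair (a , b) stands for the fraction a / b.
infix 4 _≤ᶠ_
record _≤ᶠ_ (x y : ℕ × ℕ) : Set where
  constructor cross-multiplied
  field
    cross-≤ : proj₁ x * proj₂ y ≤ proj₁ y * proj₂ x

≤ᶠ-refl : ∀ {x} → x ≤ᶠ x
≤ᶠ-refl = cross-multiplied ≤-refl

≤ᶠ-trans : ∀ {a b c d e f} → 0 < d → (a , b) ≤ᶠ (c , d) → (c , d) ≤ᶠ (e , f) → (a , b) ≤ᶠ (e , f)
≤ᶠ-trans {a} {b} {c} {d} {e} {f} 0<d (cross-multiplied ad≤cb) (cross-multiplied cf≤ed) =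
  cross-multiplied (*-cancelʳ-≤ (a * f) (e * b) d {{>-nonZero 0<d}} (begin
    a * f * d  ≡⟨ swap a f d ⟩
    a * d * f  ≤⟨ *-monoˡ-≤ f ad≤cb ⟩
    c * b * f  ≡⟨ swap c b f ⟩
    c * f * b  ≤⟨ *-monoˡ-≤ b cf≤ed ⟩
    e * d * b  ≡⟨ swap e d b ⟩
    e * b * d  ∎))
  where
  open ≤-Reasoning
  swap : ∀ x y z → x * y * z ≡ x * z * y
  swap = solve-∀

module _ (u : ℕ → ℕ × ℕ) (denominator-positive : ∀ k → 0 < proj₂ (u k)) where

  ≤ᶠ-increasing : (∀ k → u k ≤ᶠ u (suc k)) → ∀ {k l} → k ≤′ l → u k ≤ᶠ u l
  ≤ᶠ-increasing step ≤′-refl           = ≤ᶠ-refl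
  ≤ᶠ-increasing step (≤′-step {l} k≤l) = ≤ᶠ-trans (denominator-positive l) (≤ᶠ-increasing step k≤l) (step l)

  ≤ᶠ-decreasing : (∀ k → u (suc k) ≤ᶠ u k) → ∀ {k l} → k ≤′ l → u l ≤ᶠ u k
  ≤ᶠ-decreasing step ≤′-refl           = ≤ᶠ-refl
  ≤ᶠ-decreasing step (≤′-step {l} k≤l) = ≤ᶠ-trans (denominator-positive l) (step l) (≤ᶠ-decreasing step k≤l)

-- The classical approximations of e from below and from above.
e-lower : ℕ → ℕ × ℕ
e-lower k = suc k ^ k , k ^ k

e-upper : ℕ → ℕ × ℕ
e-upper m = suc m ^ suc m , m ^ suc m

n^n>0 : ∀ n → 0 < n ^ n
n^n>0 zero    = z<s
n^n>0 (suc n) = m^n>0 (suc n) (suc n)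

-- Both monotonicity steps apply Bernoulli's bounds to D = k (k + 2) = (k + 1)² − 1.
e-lower-increasing : ∀ k → e-lower k ≤ᶠ e-lower (suc k)
e-lower-increasing zero      = cross-multiplied (s≤s z≤n)
e-lower-increasing k@(suc _) = cross-multiplied (*-cancelˡ-≤ k (+-cancelʳ-≤ P (k * P) (k * (T * K)) (begin
  k * P + P                          ≡⟨ square-split k A ⟩
  s ^ suc k * s ^ suc k              ≡⟨ ^-distribʳ-* s s (suc k) ⟨
  (s * s) ^ suc k                    ≡⟨ cong (_^ suc k) (square-pred k) ⟨
  (D + 1) ^ suc k                    ≤⟨ bernoulli-upper D 1 k ⟩
  D ^ suc k + suc k * 1 * (D + 1) ^ k
    ≡⟨ cong₂ (λ x y → x + suc k * 1 * y) (^-distribʳ-* k (2 + k) (suc k))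
             (trans (cong (_^ k) (square-pred k)) (^-distribʳ-* s s k)) ⟩
  (k * K) * T + suc k * 1 * (A * A)  ≡⟨ regroup k K T A ⟩
  k * (T * K) + P                    ∎)))
  where
  open ≤-Reasoning
  s = suc k
  A = s ^ k
  K = k ^ k
  T = suc s ^ suc k
  D = k * (2 + k)
  P = A * (s * A)
  square-pred : ∀ k → k * (2 + k) + 1 ≡ suc k * suc k
  square-pred = solve-∀
  square-split : ∀ k A → k * (A * (suc k * A)) + A * (suc k * A) ≡ (suc k * A) * (suc k * A)
  square-split = solve-∀
  regroup : ∀ k K T A → (k * K) * T + suc k * 1 * (A * A) ≡ k * (T * K) + A * (suc k * A)
  regroup = solve-∀

e-upper-decreasing : ∀ m → e-upper (suc m) ≤ᶠ e-upper m
e-upper-decreasing m = cross-multiplied (*-cancelˡ-≤ s (begin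
  s * (P * M)                                  ≡⟨ factor m M Q ⟩
  D * (M * Q) + suc s * 1 * (M * Q)            ≡⟨ cong (λ x → D * x + suc s * 1 * x) (^-distribʳ-* m (2 + m) s) ⟨
  D ^ suc s + suc s * 1 * D ^ s                ≤⟨ bernoulli-lower D 1 s ⟩
  (D + 1) ^ suc s                              ≡⟨ cong (_^ suc s) (square-pred m) ⟩
  (s * s) ^ suc s                              ≡⟨ ^-distribʳ-* s s (suc s) ⟩
  s ^ suc s * s ^ suc s                        ≡⟨ regroup s (s ^ s) ⟩
  s * (s ^ s * s ^ suc s)                      ∎))
  where
  open ≤-Reasoning
  s = suc m
  M = m ^ s
  Q = (2 + m) ^ s
  P = (2 + m) * Q
  D = m * (2 + m)
  square-pred : ∀ m → m * (2 + m) + 1 ≡ suc m * suc m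
  square-pred = solve-∀
  factor : ∀ m M Q → suc m * ((2 + m) * Q * M) ≡ m * (2 + m) * (M * Q) + (2 + m) * 1 * (M * Q)
  factor = solve-∀
  regroup : ∀ s S → s * S * (s * S) ≡ s * (S * (s * S))
  regroup = solve-∀

e-lower≤e-upper : ∀ k → e-lower k ≤ᶠ e-upper k
e-lower≤e-upper k = cross-multiplied (begin
  A * (k * K)      ≡⟨ x*[y*z]≡y*[x*z] A k K ⟩
  k * (A * K)      ≤⟨ *-monoˡ-≤ (A * K) (n≤1+n k) ⟩
  suc k * (A * K)  ≡⟨ *-assoc (suc k) A K ⟨
  suc k * A * K    ∎)
  where
  open ≤-Reasoning
  A = suc k ^ k
  K = k ^ k
  x*[y*z]≡y*[x*z] : ∀ x y z → x * (y * z) ≡ y * (x * z)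
  x*[y*z]≡y*[x*z] = solve-∀

e-lower≤e-upper′ : ∀ k m → e-lower k ≤ᶠ e-upper (suc m)
e-lower≤e-upper′ k m with ≤-total k (suc m)
... | inj₁ k≤1+m =
  ≤ᶠ-trans (n^n>0 (suc m)) (≤ᶠ-increasing e-lower n^n>0 e-lower-increasing (≤⇒≤′ k≤1+m)) (e-lower≤e-upper (suc m))
e-lower≤e-upper′ (suc j) m | inj₂ (s≤s m≤j) =
  ≤ᶠ-trans (m^n>0 (suc j) (suc (suc j))) (e-lower≤e-upper (suc j))
    (≤ᶠ-decreasing (e-upper ∘ suc) (λ i → m^n>0 (suc i) (suc (suc i))) (e-upper-decreasing ∘ suc) (≤⇒≤′ m≤j))

n^n*c^n≤n!*C^n : ∀ {c C} → (∀ k → e-lower k ≤ᶠ (C , c)) → ∀ n → n ^ n * c ^ n ≤ n ! * C ^ n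
n^n*c^n≤n!*C^n             bound zero    = ≤-refl
n^n*c^n≤n!*C^n {c} {C} bound (suc n) = *-cancelˡ-≤ N {{>-nonZero (n^n>0 n)}} (begin
  N * (s * A * (c * X))       ≡⟨ shuffle N s A c X ⟩
  s * ((A * c) * (N * X))     ≤⟨ *-monoʳ-≤ s (*-mono-≤ (_≤ᶠ_.cross-≤ (bound n)) (n^n*c^n≤n!*C^n bound n)) ⟩
  s * ((C * N) * (n ! * Y))   ≡⟨ unshuffle N s (n !) C Y ⟩
  N * (s * n ! * (C * Y))     ∎)
  where
  open ≤-Reasoning
  s = suc n
  N = n ^ n
  A = s ^ n
  X = c ^ n
  Y = C ^ n
  shuffle : ∀ N s A c X → N * (s * A * (c * X)) ≡ s * ((A * c) * (N * X))
  shuffle = solve-∀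
  unshuffle : ∀ N s F C Y → s * ((C * N) * (F * Y)) ≡ N * (s * F * (C * Y))
  unshuffle = solve-∀

theorem12 : ∀ (m : ℕ) → 1 ≤ m → ∃ λ (N : ℕ) → ∀ (n : ℕ) → N ≤ n →
              n ^ n * m ^ (suc m * n) ≤ popStackedCount n * (2 * suc m ^ suc m) ^ n
theorem12 m@(suc j) _ = 0 , λ n _ → begin
  n ^ n * m ^ (suc m * n)                           ≡⟨ cong (n ^ n *_) (^-*-assoc m (suc m) n) ⟨
  n ^ n * (m ^ suc m) ^ n                           ≤⟨ n^n*c^n≤n!*C^n (λ k → e-lower≤e-upper′ k j) n ⟩
  n ! * (suc m ^ suc m) ^ n                         ≤⟨ *-monoˡ-≤ _ (n!≤popStackedCount*2^n n) ⟩
  popStackedCount n * 2 ^ n * (suc m ^ suc m) ^ n   ≡⟨ *-assoc (popStackedCount n) (2 ^ n) _ ⟩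
  popStackedCount n * (2 ^ n * (suc m ^ suc m) ^ n) ≡⟨ cong (popStackedCount n *_) (^-distribʳ-* 2 (suc m ^ suc m) n) ⟨
  popStackedCount n * (2 * suc m ^ suc m) ^ n       ∎
  where open ≤-Reasoning
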